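{- Let $G$ be a graph, let $\pi = \{W_1,\dots,W_k\}$ be a clique vertex-partition of $G$, and let $r \geq 1$. Then the $r$-independence complex $\mathrm{Ind}_r(G^\pi_r)$ of the $r$-clique whiskering $G^\pi_r$ is shellable.
   Context: All graphs are finite and simple. A clique vertex-partition of $G$ is a collection $\pi=\{W_1,\dots,W_k\}$ of pairwise disjoint cliques of $G$ (some possibly empty) with $\bigcup_i W_i = V(G)$. Given $r \ge 1$, the $r$-clique whiskering $G^\pi_r$ is defined by choosing integers $t_i \geq r$ for $1\le i\le k$, adding new vertices $x_{i,1},\dots,x_{i,t_i}$ for each $i$, and adding all edges needed so that $W_i \cup \{x_{i,1},\dots,x_{i,t_i}\}$ is a clique for each $i$; i.e. $V(G^\pi_r) = V(G)\cup\bigcup_i\{x_{i,1},\dots,x_{i,t_i}\}$ and $E(G^\pi_r) = E(G)\cup\bigcup_i\{\{a,b\} : a\ne b,\ a,b\in W_i\cup\{x_{i,1},\dots,x_{i,t_i}\}\}$. For $r \geq 1$, a subset $A$ of the vertex set is $r$-independent if every connected component of the induced subgraph on $A$ has at most $r$ vertices; $\mathrm{Ind}_r(\cdot)$ is the simplicial complex of all $r$-independent subsets. A (not necessarily pure) simplicial complex is shellable if its facets can be ordered $F_1,\dots,F_s$ so that for each $j>1$, $\langle F_j\rangle \cap \langle F_1,\dots,F_{j-1}\rangle$ is pure of dimension $\dim F_j-1$ ($\langle\mathcal F\rangle$ = complex generated by $\mathcal F$). -}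

module Defs where

open import Data.Nat using (ℕ; suc; _≤_; _<_)
open import Data.Fin using (Fin; toℕ; _≟_)
open import Data.Bool using (Bool; T; false)
open import Data.Sum using (_⊎_; inj₁; inj₂)
open import Data.Product using (Σ; Σ-syntax; ∃; ∃-syntax; _×_; _,_)
open import Data.List using (List; length)
open import Data.List.Membership.Propositional using (_∈_)
open import Data.List.Relation.Binary.Subset.Propositional using (_⊆_)
open import Data.List.Relation.Unary.Unique.Propositional using (Unique)
open import Data.List.Base using (lookup)
open import Data.Empty using (⊥)
open import Relation.Nullary using (¬_)
open import Relation.Binary.PropositionalEquality using (_≡_)
open import Function.Definitions using (Injective)

record SimpleGraph (n : ℕ) : Set where
  field
    adj       : Fin n → Fin n → Bool
    symmetric : ∀ u v → adj u v ≡ adj v u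
    irrefl    : ∀ v → adj v v ≡ false
open SimpleGraph public

-- A clique vertex-partition π = {W_1,…,W_k} (blocks possibly empty) is
-- encoded by the map  part : Fin n → Fin k  sending a vertex to the index
-- of its block, W_i = part⁻¹(i); each block must be a clique.
IsCliquePartition : ∀ {n k} → SimpleGraph n → (Fin n → Fin k) → Set
IsCliquePartition G part =
  ∀ u v → part u ≡ part v → ¬ (u ≡ v) → T (adj G u v)

-- Vertex set of the r-clique whiskering: old vertices plus x_{i,a}, a < t_i.
WVertex : (n k : ℕ) → (Fin k → ℕ) → Set
WVertex n k t = Fin n ⊎ Σ (Fin k) (λ i → Fin (t i))

-- Adjacency of the whiskering G^π_r (the bound t_i ≥ r is a hypothesis of
-- the theorem).
WAdj : ∀ {n k} → SimpleGraph n → (Fin n → Fin k) → (t : Fin k → ℕ) →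
       WVertex n k t → WVertex n k t → Set
WAdj G part t (inj₁ u) (inj₁ v) = T (adj G u v)
WAdj G part t (inj₁ u) (inj₂ (i , a)) = part u ≡ i
WAdj G part t (inj₂ (i , a)) (inj₁ v) = part v ≡ i
WAdj G part t (inj₂ (i , a)) (inj₂ (j , b)) = (i ≡ j) × ¬ (toℕ a ≡ toℕ b)

-- r-independence complexes of a graph given by a vertex type V and an
-- adjacency relation E.  Faces are duplicate-free lists of vertices.

data Reach {V : Set} (E : V → V → Set) (A : List V) : V → V → Set where
  here : ∀ {v} → v ∈ A → Reach E A v v
  step : ∀ {u w v} → u ∈ A → E u w → Reach E A w v → Reach E A u v

IsRIndependent : {V : Set} → (V → V → Set) → ℕ → List V → Set
IsRIndependent {V} E r A =
  Unique A ×
  (∀ v → v ∈ A → (f : Fin (suc r) → V) → Injective _≡_ _≡_ f →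
     (∀ j → Reach E A v (f j)) → ⊥)

Complex : Set → Set₁
Complex V = List V → Set

IsFacet : {V : Set} → Complex V → List V → Set
IsFacet Δ F = Δ F × (∀ G → Δ G → F ⊆ G → G ⊆ F)

-- S is a face of ⟨F_j⟩ ∩ ⟨F_0,…,F_{j-1}⟩  (0-based indexing)
InShellIntersection : {V : Set} (Fs : List (List V)) → Fin (length Fs) →
                      List V → Set
InShellIntersection Fs j S =
  Unique S × S ⊆ lookup Fs j ×
  (∃[ i ] ((toℕ i < toℕ j) × S ⊆ lookup Fs i))

-- that complex is pure of dimension dim F_j − 1, i.e. all its facets have
-- exactly |F_j| − 1 vertices: every face has at most |F_j| − 1 vertices
-- and lies in a face with exactly |F_j| − 1 vertices.
PureShellStep : {V : Set} (Fs : List (List V)) → Fin (length Fs) → Set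
PureShellStep Fs j =
  ∀ S → InShellIntersection Fs j S →
    (suc (length S) ≤ length (lookup Fs j)) ×
    (∃[ T ] (InShellIntersection Fs j T × S ⊆ T ×
             suc (length T) ≡ length (lookup Fs j)))

-- A shelling: a list enumerating all facets of Δ exactly once (up to
-- equality as sets), satisfying the shelling condition for every j > 1
-- (in 1-based indexing).
IsShelling : {V : Set} → Complex V → List (List V) → Set
IsShelling {V} Δ Fs =
  (∀ j → IsFacet Δ (lookup Fs j)) ×
  (∀ F → IsFacet Δ F → ∃[ j ] (F ⊆ lookup Fs j × lookup Fs j ⊆ F)) ×
  (∀ i j → lookup Fs i ⊆ lookup Fs j → lookup Fs j ⊆ lookup Fs i → i ≡ j) ×
  (∀ j → 0 < toℕ j → PureShellStep Fs j)

Shellable : {V : Set} → Complex V → Set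
Shellable Δ = ∃[ Fs ] IsShelling Δ Fs

-- The complex is vertex decomposable for the order "original vertices first, whiskers last".
-- After some vertices have been processed, the complex at hand consists of the sets A of
-- unprocessed vertices U for which A ∪ S is r-independent, S being the processed vertices
-- put into the face; its deletion and link at the next vertex x are of the same form (x is
-- dropped from U, resp. moved to S). So it suffices that x is a shedding vertex or a cone
-- point, and the shellings of deletion and link concatenate to one of the whole complex.
--
-- An original vertex v is shedding: a face of its link cannot contain all t_i ≥ r whiskers
-- of v's block, and a missing whisker can replace v, all of its neighbours being neighbours
-- of v. A whisker x whose component in the graph induced on U ∪ S has at most r vertices is
-- a cone point. Otherwise x is shedding: whiskers are simplicial, so walks can bypass the
-- whiskers outside a face; if every vertex of U reachable from x were in the face, the more
-- than r vertices of x's component would all be reachable from x inside the face. Hence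
-- some reachable y is missing from the face, and it can replace x.

module Submission where

open import Defs
open import Data.Nat using (ℕ; zero; suc; _+_; _≤_; _<_; z≤n; s≤s; s≤s⁻¹; _≤?_)
import Data.Nat as ℕ
open import Data.Nat.Properties
  using (≤-trans; ≤-refl; <-trans; <-≤-trans; m≤m+n; +-monoʳ-<; +-cancelˡ-<; ≤⇒≯; ≰⇒>)
open import Data.Fin using (Fin; toℕ; zero; suc; inject≤)
open import Data.Fin.Properties using (toℕ-injective; injective⇒≤; inject≤-injective)
open import Data.List using (List; []; _∷_; _++_; length; map; filter; lookup; allFin; concatMap; deduplicate)
open import Data.List.Properties using (length-filter; filter-reject; ++-identityʳ)
open import Data.List.Relation.Binary.Permutation.Propositional using (↭-sym)
open import Data.List.Relation.Binary.Permutation.Propositional.Properties using (shift)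
open import Data.List.Membership.Propositional using (_∈_; _∉_; find; lose)
open import Data.List.Membership.Propositional.Properties
  using (∈-filter⁺; ∈-filter⁻; ∈-lookup; ∈-++⁺ˡ; ∈-++⁺ʳ; ∈-++⁻; ∈-map⁺; ∈-map⁻; ∈-allFin;
         ∈-concatMap⁺; ∈-deduplicate⁺)
open import Data.List.Membership.Setoid.Properties using (index-injective)
open import Data.List.Relation.Binary.Subset.Propositional using (_⊆_)
open import Data.List.Relation.Binary.Subset.Propositional.Properties
  using (⊆-reflexive; ⊆-reflexive-↭; ⊆-trans; xs⊆x∷xs; ∷⁺ʳ; ∈-∷⁺ʳ; ⊆∷∧∉⇒⊆; xs⊆xs++ys; xs⊆ys++xs; ++⁺ˡ; ⊆[]⇒≡[])
open import Data.List.Relation.Unary.Unique.Propositional using (Unique)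
open import Data.List.Relation.Unary.Unique.Propositional.Properties
  using (filter⁺; map⁺; allFin⁺; Unique[x∷xs]⇒x∉xs)
  renaming (++⁺ to Unique-++⁺)
open import Data.List.Relation.Unary.Unique.DecPropositional.Properties using (deduplicate-!)
open import Data.List.Relation.Unary.AllPairs using ([]; _∷_; tail)
open import Data.List.Relation.Unary.All as All using (all?)
open import Data.List.Relation.Unary.All.Properties using (¬Any⇒All¬; ¬All⇒Any¬)
open import Data.List.Relation.Unary.Any using (here; there; any?; index)
open import Data.Product using (Σ; ∃; ∃₂; _×_; _,_; proj₁; proj₂)
open import Data.Sum using (_⊎_; inj₁; inj₂; [_,_])
open import Data.Sum.Properties using (inj₁-injective; inj₂-injective)
import Data.Sum.Properties as Sum
import Data.Product.Properties as Product
import Data.Fin as Fin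
open import Data.Bool using (T)
open import Relation.Nullary.Decidable using (T?)
open import Data.Empty using (⊥; ⊥-elim)
open import Relation.Nullary using (¬_; Dec; yes; no; ¬?; _×-dec_)
open import Relation.Binary using (DecidableEquality)
open import Relation.Binary.PropositionalEquality using (_≡_; _≢_; refl; sym; trans; cong; subst; setoid)
open import Function.Definitions using (Injective)
open import Function using (_$_)

module UniqueLists {V : Set} where

  Unique-∷ : ∀ {x : V} {xs} → x ∉ xs → Unique xs → Unique (x ∷ xs)
  Unique-∷ {xs = xs} x∉xs xs! = ¬Any⇒All¬ xs x∉xs ∷ xs!

  lookup-injective : ∀ {xs : List V} → Unique xs → Injective _≡_ _≡_ (lookup xs)
  lookup-injective {x ∷ xs} _ {zero} {zero} _ = refl
  lookup-injective {x ∷ xs} x∷xs! {zero} {suc j} x≡ =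
    ⊥-elim (Unique[x∷xs]⇒x∉xs x∷xs! (subst (_∈ xs) (sym x≡) (∈-lookup j)))
  lookup-injective {x ∷ xs} x∷xs! {suc i} {zero} ≡x =
    ⊥-elim (Unique[x∷xs]⇒x∉xs x∷xs! (subst (_∈ xs) ≡x (∈-lookup i)))
  lookup-injective {x ∷ xs} (_ ∷ xs!) {suc i} {suc j} eq = cong suc (lookup-injective xs! eq)

  injective⇒≤length : ∀ {m} {f : Fin m → V} → Injective _≡_ _≡_ f →
                      (L : List V) → (∀ j → f j ∈ L) → m ≤ length L
  injective⇒≤length f-inj L f∈L = injective⇒≤ {f = λ j → index (f∈L j)}
    (λ {i} {j} eq → f-inj (index-injective (setoid V) (f∈L i) (f∈L j) eq))

  Unique-⊆⇒length≤ : ∀ {S T : List V} → Unique S → S ⊆ T → length S ≤ length T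
  Unique-⊆⇒length≤ {S} {T} S! S⊆T =
    injective⇒≤length (lookup-injective S!) T (λ j → S⊆T (∈-lookup j))

module Removal {V : Set} (_≟_ : DecidableEquality V) where

  remove : V → List V → List V
  remove v = filter (λ z → ¬? (z ≟ v))

  remove-⊆ : ∀ v A → remove v A ⊆ A
  remove-⊆ v A p = proj₁ (∈-filter⁻ (λ z → ¬? (z ≟ v)) {xs = A} p)

  ∉-remove : ∀ v A → v ∉ remove v A
  ∉-remove v A p = proj₂ (∈-filter⁻ (λ z → ¬? (z ≟ v)) {xs = A} p) refl

  ∈-remove⁺ : ∀ {v z A} → z ∈ A → z ≢ v → z ∈ remove v A
  ∈-remove⁺ {v} = ∈-filter⁺ (λ z → ¬? (z ≟ v))

  remove-Unique : ∀ v {A} → Unique A → Unique (remove v A)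
  remove-Unique v = filter⁺ (λ z → ¬? (z ≟ v))

  ⊆-∷-remove : ∀ v A → A ⊆ v ∷ remove v A
  ⊆-∷-remove v A {z} z∈A with z ≟ v
  ... | yes refl = here refl
  ... | no z≢v = there (∈-remove⁺ z∈A z≢v)

  ⊆-remove : ∀ {v A B} → v ∉ A → A ⊆ B → A ⊆ remove v B
  ⊆-remove v∉A A⊆B z∈A = ∈-remove⁺ (A⊆B z∈A) λ { refl → v∉A z∈A }

  length-remove : ∀ {v A} → v ∈ A → length (remove v A) < length A
  length-remove {v} {y ∷ A} (here refl)
    rewrite filter-reject (λ z → ¬? (z ≟ v)) {v} {A} (λ v≢v → v≢v refl) =
    s≤s (length-filter (λ z → ¬? (z ≟ v)) A)
  length-remove {v} {y ∷ A} (there v∈A) with y ≟ v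
  ... | yes refl = s≤s (length-filter (λ z → ¬? (z ≟ v)) A)
  ... | no _ = s≤s (length-remove v∈A)

module Components {V : Set} (_≟_ : DecidableEquality V) (E : V → V → Set)
                  (E? : ∀ a b → Dec (E a b)) (E-sym : ∀ {a b} → E a b → E b a) (r : ℕ) where
  open UniqueLists
  open Removal _≟_
  open import Data.List.Membership.DecPropositional _≟_ using (_∈?_)

  reach-source : ∀ {A a b} → Reach E A a b → a ∈ A
  reach-source (here a∈A) = a∈A
  reach-source (step a∈A _ _) = a∈A

  reach-target : ∀ {A a b} → Reach E A a b → b ∈ A
  reach-target (here b∈A) = b∈A
  reach-target (step _ _ p) = reach-target p

  reach-mono : ∀ {A B a b} → A ⊆ B → Reach E A a b → Reach E B a b
  reach-mono A⊆B (here a∈A) = here (A⊆B a∈A)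
  reach-mono A⊆B (step a∈A e p) = step (A⊆B a∈A) e (reach-mono A⊆B p)

  reach-trans : ∀ {A a b c} → Reach E A a b → Reach E A b c → Reach E A a c
  reach-trans (here _) q = q
  reach-trans (step a∈A e p) q = step a∈A e (reach-trans p q)

  reach-sym : ∀ {A a b} → Reach E A a b → Reach E A b a
  reach-sym (here a∈A) = here a∈A
  reach-sym (step a∈A e p) = reach-trans (reach-sym p) (step (reach-source p) (E-sym e) (here a∈A))

  reach-map : ∀ {A B} (φ : V → V) → (∀ {z} → z ∈ A → φ z ∈ B) →
              (∀ {z z'} → z ∈ A → z' ∈ A → E z z' → Reach E B (φ z) (φ z')) →
              ∀ {a b} → Reach E A a b → Reach E B (φ a) (φ b)
  reach-map φ φ∈B φ-edge (here a∈A) = here (φ∈B a∈A)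
  reach-map φ φ∈B φ-edge (step a∈A e p) =
    reach-trans (φ-edge a∈A (reach-source p) e) (reach-map φ φ∈B φ-edge p)

  reach-∷⁻ : ∀ {x B w v} → Reach E (x ∷ B) w v → Reach E B w v ⊎ Reach E (x ∷ B) w x
  reach-∷⁻ {x} (here {v = w} w∈) with w ≟ x | w∈
  ... | yes refl | _ = inj₂ (here w∈)
  ... | no w≢x | here w≡x = ⊥-elim (w≢x w≡x)
  ... | no _ | there w∈B = inj₁ (here w∈B)
  reach-∷⁻ {x} (step {u = w} w∈ e p) with reach-∷⁻ p
  ... | inj₂ p' = inj₂ (step w∈ e p')
  ... | inj₁ p' with w ≟ x | w∈
  ...   | yes refl | _ = inj₂ (here w∈)
  ...   | no w≢x | here w≡x = ⊥-elim (w≢x w≡x)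
  ...   | no _ | there w∈B = inj₁ (step w∈B e p')

  reach-last-exit : ∀ {x A a b} → Reach E A a b →
                    Reach E (remove x A) a b ⊎ (x ≡ b ⊎ ∃ λ w → E x w × Reach E (remove x A) w b)
  reach-last-exit {x} (here {v = a} a∈A) with a ≟ x
  ... | yes refl = inj₂ (inj₁ refl)
  ... | no a≢x = inj₁ (here (∈-remove⁺ a∈A a≢x))
  reach-last-exit {x} (step {u = a} a∈A e p) with reach-last-exit {x} p
  ... | inj₂ exit = inj₂ exit
  ... | inj₁ p' with a ≟ x
  ...   | yes refl = inj₂ (inj₂ (_ , e , p'))
  ...   | no a≢x = inj₁ (step (∈-remove⁺ a∈A a≢x) e p')

  reach-first-step : ∀ {A u v} → Reach E A u v → u ≡ v ⊎ ∃ λ w → E u w × Reach E (remove u A) w v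
  reach-first-step {A} {u} p with reach-last-exit {u} p
  ... | inj₁ p' = ⊥-elim (∉-remove u A (reach-source p'))
  ... | inj₂ exit = exit

  reach? : (A : List V) (u v : V) → Dec (Reach E A u v)
  reach? A = bounded (length A) A ≤-refl
    where
    bounded : (fuel : ℕ) (A : List V) → length A ≤ fuel → (u v : V) → Dec (Reach E A u v)
    bounded fuel A A≤fuel u v with u ∈? A
    ... | no u∉A = no λ p → u∉A (reach-source p)
    ... | yes u∈A with u ≟ v
    ...   | yes refl = yes (here u∈A)
    bounded zero [] _ u v | yes () | no _
    bounded (suc fuel) A A≤fuel u v | yes u∈A | no u≢v
      with any? (λ w → E? u w ×-dec bounded fuel (remove u A) (s≤s⁻¹ (≤-trans (length-remove u∈A) A≤fuel)) w v)
                (remove u A)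
    ... | yes via with find via
    ...   | w , _ , e , p = yes (step u∈A e (reach-mono (remove-⊆ u A) p))
    bounded (suc fuel) A A≤fuel u v | yes u∈A | no u≢v | no ¬via = no λ p → first-step (reach-first-step p)
      where
      first-step : u ≡ v ⊎ (∃ λ w → E u w × Reach E (remove u A) w v) → ⊥
      first-step (inj₁ u≡v) = u≢v u≡v
      first-step (inj₂ (w , e , p)) = ¬via (lose (reach-source p) (e , p))

  component : List V → V → List V
  component A w = filter (reach? A w) A

  ∈-component⁺ : ∀ {A w z} → Reach E A w z → z ∈ component A w
  ∈-component⁺ {A} {w} p = ∈-filter⁺ (reach? A w) (reach-target p) p

  ∈-component⁻ : ∀ {A w z} → z ∈ component A w → Reach E A w z
  ∈-component⁻ {A} {w} z∈ = proj₂ (∈-filter⁻ (reach? A w) {xs = A} z∈)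

  component-Unique : ∀ {A} w → Unique A → Unique (component A w)
  component-Unique {A} w = filter⁺ (reach? A w)

  -- The second half of IsRIndependent; unlike the first, it is closed under ⊆, which lets
  -- faces be rearranged as sets.
  SmallComponents : List V → Set
  SmallComponents A =
    ∀ v → v ∈ A → (f : Fin (suc r) → V) → Injective _≡_ _≡_ f → (∀ j → Reach E A v (f j)) → ⊥

  SmallComponents-⊆ : ∀ {A B} → A ⊆ B → SmallComponents B → SmallComponents A
  SmallComponents-⊆ A⊆B small v v∈A f f-inj reach = small v (A⊆B v∈A) f f-inj (λ j → reach-mono A⊆B (reach j))

  large-component : ∀ {A w} → SmallComponents A → w ∈ A → (L : List V) → Unique L → r < length L →
                    (∀ {z} → z ∈ L → Reach E A w z) → ⊥
  large-component small w∈A L L! r<L reach =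
    small _ w∈A (λ j → lookup L (inject≤ j r<L))
      (λ eq → inject≤-injective r<L r<L _ _ (lookup-injective L! eq))
      (λ j → reach (∈-lookup (inject≤ j r<L)))

  SmallComponents-∷ : ∀ {x B} → SmallComponents B → (L : List V) → length L ≤ r →
                      (∀ {z} → Reach E (x ∷ B) x z → z ∈ L) → SmallComponents (x ∷ B)
  SmallComponents-∷ {x} {B} small L L≤r x-within-L w w∈ f f-inj reach with reach? (x ∷ B) w x
  ... | yes w→x = ≤⇒≯ L≤r (injective⇒≤length f-inj L λ j → x-within-L (reach-trans (reach-sym w→x) (reach j)))
  ... | no ¬w→x = small w (w∈B w∈) f f-inj (λ j → avoid (reach-∷⁻ (reach j)))
    where
    avoid : ∀ {z} → Reach E B w z ⊎ Reach E (x ∷ B) w x → Reach E B w z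
    avoid (inj₁ p) = p
    avoid (inj₂ p) = ⊥-elim (¬w→x p)
    w∈B : w ∈ x ∷ B → w ∈ B
    w∈B (here refl) = ⊥-elim (¬w→x (here w∈))
    w∈B (there w∈B) = w∈B

  SmallComponents? : ∀ {A} → Unique A → Dec (SmallComponents A)
  SmallComponents? {A} A! with all? (λ w → length (component A w) ≤? r) A
  ... | yes bounded = yes λ w w∈A f f-inj reach →
          ≤⇒≯ (All.lookup bounded w∈A) (injective⇒≤length f-inj _ (λ j → ∈-component⁺ (reach j)))
  ... | no ¬bounded with find (¬All⇒Any¬ (λ w → length (component A w) ≤? r) A ¬bounded)
  ...   | w , w∈A , large = no λ small →
          large-component small w∈A (component A w) (component-Unique w A!) (≰⇒> large) ∈-component⁻

  SmallComponents-image : ∀ {A B} → SmallComponents B → (φ : V → V) → (∀ {z} → z ∈ A → φ z ∈ B) →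
                          (∀ {z z'} → z ∈ A → z' ∈ A → φ z ≡ φ z' → z ≡ z') →
                          (∀ {z z'} → z ∈ A → z' ∈ A → E z z' → Reach E B (φ z) (φ z')) →
                          SmallComponents A
  SmallComponents-image small φ φ∈B φ-inj φ-edge w w∈A f f-inj reach =
    small (φ w) (φ∈B w∈A) (λ j → φ (f j))
      (λ {i} {j} eq → f-inj (φ-inj (reach-target (reach i)) (reach-target (reach j)) eq))
      (λ j → reach-map φ φ∈B φ-edge (reach j))

  SmallComponents-exchange : ∀ {p q L} → SmallComponents (p ∷ L) → p ∉ L →
                             (∀ {z} → z ∈ L → E q z → Reach E (p ∷ L) p z) → SmallComponents (q ∷ L)
  SmallComponents-exchange {p} {q} {L} small p∉L q-edge =
    SmallComponents-image small φ φ∈ φ-inj φ-edge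
    where
    φ : V → V
    φ z with z ≟ q
    ... | yes _ = p
    ... | no _ = z
    ∈L : ∀ {z} → z ∈ q ∷ L → z ≢ q → z ∈ L
    ∈L (here z≡q) z≢q = ⊥-elim (z≢q z≡q)
    ∈L (there z∈L) _ = z∈L
    φ∈ : ∀ {z} → z ∈ q ∷ L → φ z ∈ p ∷ L
    φ∈ {z} z∈ with z ≟ q
    ... | yes _ = here refl
    ... | no z≢q = there (∈L z∈ z≢q)
    φ-inj : ∀ {z z'} → z ∈ q ∷ L → z' ∈ q ∷ L → φ z ≡ φ z' → z ≡ z'
    φ-inj {z} {z'} z∈ z'∈ eq with z ≟ q | z' ≟ q
    ... | yes z≡q | yes z'≡q = trans z≡q (sym z'≡q)
    ... | yes _ | no z'≢q = ⊥-elim (p∉L (subst (_∈ L) (sym eq) (∈L z'∈ z'≢q)))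
    ... | no z≢q | yes _ = ⊥-elim (p∉L (subst (_∈ L) eq (∈L z∈ z≢q)))
    ... | no _ | no _ = eq
    φ-edge : ∀ {z z'} → z ∈ q ∷ L → z' ∈ q ∷ L → E z z' → Reach E (p ∷ L) (φ z) (φ z')
    φ-edge {z} {z'} z∈ z'∈ e with z ≟ q | z' ≟ q
    ... | yes refl | yes refl = here (here refl)
    ... | yes refl | no z'≢q = q-edge (∈L z'∈ z'≢q) e
    ... | no z≢q | yes refl = reach-sym (q-edge (∈L z∈ z≢q) (E-sym e))
    ... | no z≢q | no z'≢q = step (there (∈L z∈ z≢q)) e (here (there (∈L z'∈ z'≢q)))

  Simplicial : V → Set
  Simplicial w = ∀ {c d} → E w c → E w d → c ≢ d → E c d

  module Shortcut {W : V → Set} (W? : ∀ z → Dec (W z)) (W-simplicial : ∀ {w} → W w → Simplicial w)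
                  {Z X : List V} (Z∖W⊆X : ∀ {z} → z ∈ Z → ¬ W z → z ∈ X) where

    -- The walk in X has reached a, which is c or a neighbour of c. A simplicial c can be
    -- skipped, since its neighbours before and after it on the walk are adjacent.
    reroute : ∀ {a c b} → a ∈ X → a ≡ c ⊎ E a c → Reach E Z c b → ¬ W b → Reach E X a b
    reroute a∈X (inj₁ refl) (here _) _ = here a∈X
    reroute a∈X (inj₂ e) (here b∈Z) ¬Wb = step a∈X e (here (Z∖W⊆X b∈Z ¬Wb))
    reroute a∈X (inj₁ refl) (step _ e p) ¬Wb = reroute a∈X (inj₂ e) p ¬Wb
    reroute {a} a∈X (inj₂ e) (step {u = c} {w = d} c∈Z e' p) ¬Wb with W? c
    ... | no ¬Wc = step a∈X e (reroute (Z∖W⊆X c∈Z ¬Wc) (inj₂ e') p ¬Wb)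
    ... | yes Wc with a ≟ d
    ...   | yes a≡d = reroute a∈X (inj₁ a≡d) p ¬Wb
    ...   | no a≢d = reroute a∈X (inj₂ (W-simplicial Wc (E-sym e) e' a≢d)) p ¬Wb

    shortcut : ∀ {a b} → Reach E Z a b → ¬ W a → ¬ W b → Reach E X a b
    shortcut p ¬Wa ¬Wb = reroute (Z∖W⊆X (reach-source p) ¬Wa) (inj₁ refl) p ¬Wb

module Shellings {V : Set} (_≟_ : DecidableEquality V) where
  open UniqueLists
  open Removal _≟_
  open import Data.List.Membership.DecPropositional _≟_ using (_∈?_)

  record IsComplex (Δ : Complex V) : Set where
    field
      face-Unique : ∀ {A} → Δ A → Unique A
      face-down   : ∀ {A B} → Δ B → Unique A → A ⊆ B → Δ A
  open IsComplex

  link : Complex V → V → Complex V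
  link Δ v A = Δ (v ∷ A) × v ∉ A

  deletion : Complex V → V → Complex V
  deletion Δ v A = Δ A × v ∉ A

  IsConePoint : Complex V → V → Set
  IsConePoint Δ v = ∀ {A} → Δ A → v ∉ A → Δ (v ∷ A)

  -- Equivalently: no face of the link is a facet of the deletion.
  IsShedding : Complex V → V → Set
  IsShedding Δ v = ∀ {A} → link Δ v A → ∃ λ B → deletion Δ v B × A ⊆ B × ¬ B ⊆ A

  data At : List (List V) → ℕ → List V → Set where
    at-head : ∀ {F Fs} → At (F ∷ Fs) 0 F
    at-tail : ∀ {F G Fs j} → At Fs j F → At (G ∷ Fs) (suc j) F

  InEarlierFacet : List (List V) → ℕ → List V → Set
  InEarlierFacet Fs j S = ∃₂ λ i F → i < j × At Fs i F × S ⊆ F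

  HasEarlierRidge : List (List V) → ℕ → List V → List V → Set
  HasEarlierRidge Fs j F S =
    ∃ λ T → Unique T × S ⊆ T × T ⊆ F × suc (length T) ≡ length F × InEarlierFacet Fs j T

  -- IsShelling with positions in ℕ, so that shellings can be concatenated, and with every
  -- face (not only every facet) contained in a listed facet.
  record IsListShelling (Δ : Complex V) (Fs : List (List V)) : Set where
    field
      facet     : ∀ {j F} → At Fs j F → IsFacet Δ F
      generates : ∀ {A} → Δ A → ∃₂ λ j F → At Fs j F × A ⊆ F
      distinct  : ∀ {i j F F'} → At Fs i F → At Fs j F' → F ⊆ F' → F' ⊆ F → i ≡ j
      ridge     : ∀ {j F} → At Fs j F → ∀ S → Unique S → S ⊆ F → InEarlierFacet Fs j S →
                  HasEarlierRidge Fs j F S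
  open IsListShelling

  ListShellable : Complex V → Set
  ListShellable Δ = Σ (List (List V)) (IsListShelling Δ)

  at-++ˡ : ∀ {Fs Gs j F} → At Fs j F → At (Fs ++ Gs) j F
  at-++ˡ at-head = at-head
  at-++ˡ (at-tail a) = at-tail (at-++ˡ a)

  at-++ʳ : ∀ Fs {Gs j F} → At Gs j F → At (Fs ++ Gs) (length Fs + j) F
  at-++ʳ [] a = a
  at-++ʳ (_ ∷ Fs) a = at-tail (at-++ʳ Fs a)

  at-< : ∀ {Fs j F} → At Fs j F → j < length Fs
  at-< at-head = s≤s z≤n
  at-< (at-tail a) = s≤s (at-< a)

  data At-++ (Fs Gs : List (List V)) (F : List V) : ℕ → Set where
    in-left  : ∀ {j} → At Fs j F → At-++ Fs Gs F j
    in-right : ∀ {j} → At Gs j F → At-++ Fs Gs F (length Fs + j)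

  at-++⁻ : ∀ Fs {Gs j F} → At (Fs ++ Gs) j F → At-++ Fs Gs F j
  at-++⁻ [] a = in-right a
  at-++⁻ (_ ∷ Fs) at-head = in-left at-head
  at-++⁻ (_ ∷ Fs) (at-tail a) with at-++⁻ Fs a
  ... | in-left b = in-left (at-tail b)
  ... | in-right b = in-right b

  at-map⁺ : ∀ {f : List V → List V} {Fs j F} → At Fs j F → At (map f Fs) j (f F)
  at-map⁺ at-head = at-head
  at-map⁺ (at-tail a) = at-tail (at-map⁺ a)

  at-map⁻ : ∀ {f : List V → List V} Fs {j H} → At (map f Fs) j H → ∃ λ F → H ≡ f F × At Fs j F
  at-map⁻ (F ∷ Fs) at-head = F , refl , at-head
  at-map⁻ (F ∷ Fs) (at-tail a) with at-map⁻ Fs a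
  ... | G , refl , b = G , refl , at-tail b

  at-lookup : ∀ Fs (j : Fin (length Fs)) → At Fs (toℕ j) (lookup Fs j)
  at-lookup (F ∷ Fs) zero = at-head
  at-lookup (F ∷ Fs) (suc j) = at-tail (at-lookup Fs j)

  lookup-at : ∀ {Fs j F} → At Fs j F → ∃ λ (i : Fin (length Fs)) → toℕ i ≡ j × lookup Fs i ≡ F
  lookup-at at-head = zero , refl , refl
  lookup-at (at-tail a) with lookup-at a
  ... | i , refl , eq = suc i , refl , eq

  earlier-++ˡ : ∀ {Fs Gs j T} → InEarlierFacet Fs j T → InEarlierFacet (Fs ++ Gs) j T
  earlier-++ˡ (i , F , i<j , a , T⊆F) = i , F , i<j , at-++ˡ a , T⊆F

  empty-shelling : ∀ {Δ : Complex V} → (∀ {A} → ¬ Δ A) → IsListShelling Δ []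
  empty-shelling no-face = record
    { facet = λ ()
    ; generates = λ d → ⊥-elim (no-face d)
    ; distinct = λ ()
    ; ridge = λ () }

  point-shelling : ∀ {Δ : Complex V} → Δ [] → (∀ {A} → Δ A → A ≡ []) → IsListShelling Δ ([] ∷ [])
  point-shelling {Δ} empty-face only-empty = record
    { facet = λ { at-head → empty-face , λ A d _ → ⊆-reflexive-[] (only-empty d) }
    ; generates = λ d → 0 , [] , at-head , ⊆-reflexive-[] (only-empty d)
    ; distinct = λ { at-head at-head _ _ → refl }
    ; ridge = λ { at-head S _ _ (_ , _ , () , _) } }
    where
    ⊆-reflexive-[] : ∀ {A : List V} → A ≡ [] → A ⊆ []
    ⊆-reflexive-[] refl = λ ()

  shelling-resp-⇔ : ∀ {Δ Δ' : Complex V} {Fs} → (∀ {A} → Δ A → Δ' A) → (∀ {A} → Δ' A → Δ A) →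
                    IsListShelling Δ Fs → IsListShelling Δ' Fs
  shelling-resp-⇔ {Δ} {Δ'} to from sh = record
    { facet = λ a → let (d , maximal) = facet sh a in to d , λ A d' → maximal A (from d')
    ; generates = λ d → generates sh (from d)
    ; distinct = distinct sh
    ; ridge = ridge sh }

  list-shelling⇒shelling : ∀ {Δ : Complex V} {Fs} → IsListShelling Δ Fs → IsShelling Δ Fs
  list-shelling⇒shelling {Δ} {Fs} sh = facets , complete , distinct-facets , pure-steps
    where
    facets : ∀ j → IsFacet Δ (lookup Fs j)
    facets j = facet sh (at-lookup Fs j)
    complete : ∀ F → IsFacet Δ F → ∃ λ j → F ⊆ lookup Fs j × lookup Fs j ⊆ F
    complete F (d , maximal) with generates sh d
    ... | _ , F' , a , F⊆F' with lookup-at a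
    ...   | j , _ , refl = j , F⊆F' , maximal F' (proj₁ (facet sh a)) F⊆F'
    distinct-facets : ∀ i j → lookup Fs i ⊆ lookup Fs j → lookup Fs j ⊆ lookup Fs i → i ≡ j
    distinct-facets i j Fi⊆Fj Fj⊆Fi = toℕ-injective (distinct sh (at-lookup Fs i) (at-lookup Fs j) Fi⊆Fj Fj⊆Fi)
    pure-steps : ∀ j → 0 < toℕ j → PureShellStep Fs j
    pure-steps j _ S (S! , S⊆F , i , i<j , S⊆Fi)
      with ridge sh (at-lookup Fs j) S S! S⊆F (toℕ i , lookup Fs i , i<j , at-lookup Fs i , S⊆Fi)
    ... | T , T! , S⊆T , T⊆F , codim1 , _ , _ , i'<j , a , T⊆F' with lookup-at a
    ...   | i' , refl , refl =
      subst (suc (length S) ≤_) codim1 (s≤s (Unique-⊆⇒length≤ S! S⊆T)) ,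
      T , (T! , T⊆F , i' , i'<j , T⊆F') , S⊆T , codim1

  module LinkDeletion {Δ : Complex V} (Δ-complex : IsComplex Δ) (v : V) where

    link-Unique : ∀ {A} → link Δ v A → Unique A
    link-Unique (d , _) = tail (face-Unique Δ-complex d)

    link⇒deletion : ∀ {A} → link Δ v A → deletion Δ v A
    link⇒deletion {A} l@(d , v∉A) = face-down Δ-complex d (link-Unique l) (xs⊆x∷xs A v) , v∉A

    face⇒link-remove : ∀ {A} → Δ A → v ∈ A → link Δ v (remove v A)
    face⇒link-remove {A} d v∈A =
      face-down Δ-complex d (Unique-∷ (∉-remove v A) (remove-Unique v (face-Unique Δ-complex d)))
        (∈-∷⁺ʳ v∈A (remove-⊆ v A)) ,
      ∉-remove v A

    link-facet⇒facet : ∀ {G} → IsFacet (link Δ v) G → IsFacet Δ (v ∷ G)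
    link-facet⇒facet {G} ((d , v∉G) , maximal) = d , λ H dH v∷G⊆H →
      ⊆-trans (⊆-∷-remove v H)
        (∷⁺ʳ v (maximal (remove v H) (face⇒link-remove dH (v∷G⊆H (here refl)))
                  (⊆-remove v∉G (λ z∈G → v∷G⊆H (there z∈G)))))

    shedding⇒deletion-facet : IsShedding Δ v → ∀ {F} → IsFacet (deletion Δ v) F → IsFacet Δ F
    shedding⇒deletion-facet shedding {F} ((d , v∉F) , maximal) = d , extend
      where
      extend : ∀ H → Δ H → F ⊆ H → H ⊆ F
      extend H dH F⊆H with v ∈? H
      ... | no v∉H = maximal H (dH , v∉H) F⊆H
      ... | yes v∈H with shedding (face⇒link-remove dH v∈H)
      ...   | B , dB , H'⊆B , B⊈H' =
              ⊥-elim (B⊈H' (⊆-trans (maximal B dB (⊆-trans F⊆H' H'⊆B)) F⊆H'))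
        where
        F⊆H' : F ⊆ remove v H
        F⊆H' = ⊆-remove v∉F F⊆H

  module LinkCone {Δ : Complex V} (Δ-complex : IsComplex Δ) (v : V) {Fl : List (List V)}
                  (Fl-shelling : IsListShelling (link Δ v) Fl) where
    open LinkDeletion Δ-complex v

    coned-facet : ∀ {j F} → At (map (v ∷_) Fl) j F → IsFacet Δ F
    coned-facet a with at-map⁻ Fl a
    ... | G , refl , b = link-facet⇒facet (facet Fl-shelling b)

    coned-generates : ∀ {A} → Δ A → v ∈ A → ∃₂ λ j F → At (map (v ∷_) Fl) j F × A ⊆ F
    coned-generates {A} d v∈A with generates Fl-shelling (face⇒link-remove d v∈A)
    ... | j , G , a , A'⊆G = j , v ∷ G , at-map⁺ a , ⊆-trans (⊆-∷-remove v A) (∷⁺ʳ v A'⊆G)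

    coned-distinct : ∀ {i j F F'} → At (map (v ∷_) Fl) i F → At (map (v ∷_) Fl) j F' →
                     F ⊆ F' → F' ⊆ F → i ≡ j
    coned-distinct a a' F⊆F' F'⊆F with at-map⁻ Fl a | at-map⁻ Fl a'
    ... | G , refl , b | G' , refl , b' =
      distinct Fl-shelling b b' (strip b (⊆-trans (xs⊆x∷xs G v) F⊆F')) (strip b' (⊆-trans (xs⊆x∷xs G' v) F'⊆F))
      where
      strip : ∀ {j G H} → At Fl j G → G ⊆ v ∷ H → G ⊆ H
      strip b G⊆ = ⊆∷∧∉⇒⊆ G⊆ (proj₂ (proj₁ (facet Fl-shelling b)))

    coned-ridge : ∀ Fd {j G S} → At Fl j G → Unique S → S ⊆ v ∷ G → InEarlierFacet (map (v ∷_) Fl) j S →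
                  HasEarlierRidge (Fd ++ map (v ∷_) Fl) (length Fd + j) (v ∷ G) S
    coned-ridge Fd {S = S} b S! S⊆F (i , F' , i<j , a' , S⊆F') with at-map⁻ Fl a'
    ... | G' , refl , b'
      with ridge Fl-shelling b (remove v S) (remove-Unique v S!) (drop-v S⊆F) (i , G' , i<j , b' , drop-v S⊆F')
      where
      drop-v : ∀ {H} → S ⊆ v ∷ H → remove v S ⊆ H
      drop-v S⊆ = ⊆∷∧∉⇒⊆ (⊆-trans (remove-⊆ v S) S⊆) (∉-remove v S)
    ... | T , T! , S'⊆T , T⊆G , codim1 , i' , G'' , i'<j , b'' , T⊆G'' =
      v ∷ T , Unique-∷ (λ v∈T → v∉G (T⊆G v∈T)) T! , ⊆-trans (⊆-∷-remove v S) (∷⁺ʳ v S'⊆T) ,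
      ∷⁺ʳ v T⊆G , cong suc codim1 ,
      length Fd + i' , v ∷ G'' , +-monoʳ-< (length Fd) i'<j , at-++ʳ Fd (at-map⁺ b'') , ∷⁺ʳ v T⊆G''
      where
      v∉G = proj₂ (proj₁ (facet Fl-shelling b))

  cone-shelling : ∀ {Δ : Complex V} {v Fl} → IsComplex Δ → IsConePoint Δ v →
                  IsListShelling (link Δ v) Fl → IsListShelling Δ (map (v ∷_) Fl)
  cone-shelling {Δ} {v} {Fl} Δ-complex cone Fl-shelling = record
    { facet = coned-facet
    ; generates = generates'
    ; distinct = coned-distinct
    ; ridge = ridge' }
    where
    open LinkCone Δ-complex v Fl-shelling
    generates' : ∀ {A} → Δ A → ∃₂ λ j F → At (map (v ∷_) Fl) j F × A ⊆ F
    generates' {A} d with v ∈? A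
    ... | yes v∈A = coned-generates d v∈A
    ... | no v∉A with coned-generates (cone d v∉A) (here refl)
    ...   | j , F , a , v∷A⊆F = j , F , a , ⊆-trans (xs⊆x∷xs A v) v∷A⊆F
    ridge' : ∀ {j F} → At (map (v ∷_) Fl) j F → ∀ S → Unique S → S ⊆ F →
             InEarlierFacet (map (v ∷_) Fl) j S → HasEarlierRidge (map (v ∷_) Fl) j F S
    ridge' a S S! S⊆F earlier with at-map⁻ Fl a
    ... | G , refl , b = coned-ridge [] b S! S⊆F earlier

  vertex-decomposition : ∀ {Δ : Complex V} {v Fd Fl} → IsComplex Δ → IsShedding Δ v →
                         IsListShelling (deletion Δ v) Fd → IsListShelling (link Δ v) Fl →
                         IsListShelling Δ (Fd ++ map (v ∷_) Fl)
  vertex-decomposition {Δ} {v} {Fd} {Fl} Δ-complex shedding Fd-shelling Fl-shelling = record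
    { facet = facet'
    ; generates = generates'
    ; distinct = distinct'
    ; ridge = ridge' }
    where
    open LinkDeletion Δ-complex v
    open LinkCone Δ-complex v Fl-shelling
    Fs = Fd ++ map (v ∷_) Fl

    v∉deletion-facet : ∀ {j F} → At Fd j F → v ∉ F
    v∉deletion-facet a = proj₂ (proj₁ (facet Fd-shelling a))

    facet' : ∀ {j F} → At Fs j F → IsFacet Δ F
    facet' a with at-++⁻ Fd a
    ... | in-left b = shedding⇒deletion-facet shedding (facet Fd-shelling b)
    ... | in-right b = coned-facet b

    generates' : ∀ {A} → Δ A → ∃₂ λ j F → At Fs j F × A ⊆ F
    generates' {A} d with v ∈? A
    ... | yes v∈A with coned-generates d v∈A
    ...   | j , F , a , A⊆F = length Fd + j , F , at-++ʳ Fd a , A⊆F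
    generates' {A} d | no v∉A with generates Fd-shelling (d , v∉A)
    ...   | j , F , a , A⊆F = j , F , at-++ˡ a , A⊆F

    distinct' : ∀ {i j F F'} → At Fs i F → At Fs j F' → F ⊆ F' → F' ⊆ F → i ≡ j
    distinct' a a' F⊆F' F'⊆F with at-++⁻ Fd a | at-++⁻ Fd a'
    ... | in-left b | in-left b' = distinct Fd-shelling b b' F⊆F' F'⊆F
    ... | in-left b | in-right b' with at-map⁻ Fl b'
    ...   | _ , refl , _ = ⊥-elim (v∉deletion-facet b (F'⊆F (here refl)))
    distinct' a a' F⊆F' F'⊆F | in-right b | in-left b' with at-map⁻ Fl b
    ...   | _ , refl , _ = ⊥-elim (v∉deletion-facet b' (F⊆F' (here refl)))
    distinct' a a' F⊆F' F'⊆F | in-right b | in-right b' = cong (length Fd +_) (coned-distinct b b' F⊆F' F'⊆F)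

    ridge' : ∀ {j F} → At Fs j F → ∀ S → Unique S → S ⊆ F → InEarlierFacet Fs j S → HasEarlierRidge Fs j F S
    ridge' a S S! S⊆F (i , F' , i<j , a' , S⊆F') with at-++⁻ Fd a | at-++⁻ Fd a'
    ... | in-left b | in-left b' with ridge Fd-shelling b S S! S⊆F (i , F' , i<j , b' , S⊆F')
    ...   | T , T! , S⊆T , T⊆F , codim1 , earlier = T , T! , S⊆T , T⊆F , codim1 , earlier-++ˡ earlier
    ridge' a S S! S⊆F (_ , F' , i<j , a' , S⊆F') | in-left b | in-right b' =
      ⊥-elim (≤⇒≯ (m≤m+n (length Fd) _) (<-trans i<j (at-< b)))
    ridge' a S S! S⊆F (i , F' , i<j , a' , S⊆F') | in-right {j} b | in-left b' with at-map⁻ Fl b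
    ... | G , refl , c with generates Fd-shelling (link⇒deletion (proj₁ (facet Fl-shelling c)))
    ...   | i' , F'' , b'' , G⊆F'' =
      G , link-Unique (proj₁ (facet Fl-shelling c)) ,
      ⊆∷∧∉⇒⊆ S⊆F (λ v∈S → v∉deletion-facet b' (S⊆F' v∈S)) , xs⊆x∷xs G v , refl ,
      i' , F'' , <-≤-trans (at-< b'') (m≤m+n (length Fd) j) , at-++ˡ b'' , G⊆F''
    ridge' a S S! S⊆F (_ , F' , i<j , a' , S⊆F') | in-right {j} b | in-right {i} b' with at-map⁻ Fl b
    ... | G , refl , c = coned-ridge Fd c S! S⊆F (i , F' , +-cancelˡ-< (length Fd) i j i<j , b' , S⊆F')

module Whiskering {n k : ℕ} (G : SimpleGraph n) (part : Fin n → Fin k) (clique : IsCliquePartition G part)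
                  (r : ℕ) (t : Fin k → ℕ) (r≤t : ∀ i → r ≤ t i) where

  Whisker : Set
  Whisker = Σ (Fin k) (λ i → Fin (t i))

  Vertex : Set
  Vertex = WVertex n k t

  Edge : Vertex → Vertex → Set
  Edge = WAdj G part t

  _≟ʷ_ : DecidableEquality Whisker
  _≟ʷ_ = Product.≡-dec Fin._≟_ Fin._≟_

  _≟_ : DecidableEquality Vertex
  _≟_ = Sum.≡-dec Fin._≟_ _≟ʷ_

  edge? : ∀ a b → Dec (Edge a b)
  edge? (inj₁ u) (inj₁ v) = T? (adj G u v)
  edge? (inj₁ u) (inj₂ (i , _)) = part u Fin.≟ i
  edge? (inj₂ (i , _)) (inj₁ v) = part v Fin.≟ i
  edge? (inj₂ (i , a)) (inj₂ (j , b)) = (i Fin.≟ j) ×-dec ¬? (toℕ a ℕ.≟ toℕ b)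

  edge-sym : ∀ {a b} → Edge a b → Edge b a
  edge-sym {inj₁ u} {inj₁ v} e = subst T (symmetric G u v) e
  edge-sym {inj₁ _} {inj₂ _} e = e
  edge-sym {inj₂ _} {inj₁ _} e = e
  edge-sym {inj₂ _} {inj₂ _} (refl , a≢b) = refl , λ b≡a → a≢b (sym b≡a)

  block : Vertex → Fin k
  block (inj₁ u) = part u
  block (inj₂ (i , _)) = i

  block-clique : ∀ {z z'} → block z ≡ block z' → z ≢ z' → Edge z z'
  block-clique {inj₁ u} {inj₁ v} same u≢v = clique u v same (λ u≡v → u≢v (cong inj₁ u≡v))
  block-clique {inj₁ _} {inj₂ _} same _ = same
  block-clique {inj₂ _} {inj₁ _} same _ = sym same
  block-clique {inj₂ (i , a)} {inj₂ (.i , b)} refl a≢b =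
    refl , λ a≡b → a≢b (cong (λ c → inj₂ (i , c)) (toℕ-injective a≡b))

  whisker-edge-block : ∀ w z → Edge (inj₂ w) z → block z ≡ proj₁ w
  whisker-edge-block _ (inj₁ _) e = e
  whisker-edge-block _ (inj₂ _) (i≡j , _) = sym i≡j

  open Components _≟_ Edge edge? (λ {a} {b} → edge-sym {a} {b}) r
  open Shellings _≟_
  open UniqueLists
  open import Data.List.Membership.DecPropositional _≟_ using (_∈?_)

  whisker-simplicial : ∀ w → Simplicial (inj₂ w)
  whisker-simplicial w {c} {d} e e' =
    block-clique (trans (whisker-edge-block w c e) (sym (whisker-edge-block w d e')))

  -- For S disjoint from U: the link of S in Ind_r of the graph induced on U ∪ S.
  IndLink : List Vertex → List Vertex → Complex Vertex
  IndLink S U A = Unique A × A ⊆ U × SmallComponents (A ++ S)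

  record Separated (U S : List Vertex) : Set where
    field
      U-Unique : Unique U
      S-Unique : Unique S
      disjoint : ∀ {z} → z ∈ U → z ∉ S
  open Separated

  separated-Unique : ∀ {U S} → Separated U S → Unique (U ++ S)
  separated-Unique sep = Unique-++⁺ (U-Unique sep) (S-Unique sep) (λ (z∈U , z∈S) → disjoint sep z∈U z∈S)

  separated-tail : ∀ {x U S} → Separated (x ∷ U) S → Separated U S
  separated-tail sep = record
    { U-Unique = tail (U-Unique sep) ; S-Unique = S-Unique sep ; disjoint = λ z∈U → disjoint sep (there z∈U) }

  separated-move : ∀ {x U S} → Separated (x ∷ U) S → Separated U (x ∷ S)
  separated-move sep = record
    { U-Unique = tail (U-Unique sep)
    ; S-Unique = Unique-∷ (disjoint sep (here refl)) (S-Unique sep)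
    ; disjoint = λ { z∈U (here refl) → Unique[x∷xs]⇒x∉xs (U-Unique sep) z∈U
                   ; z∈U (there z∈S) → disjoint sep (there z∈U) z∈S } }

  IndLink-complex : ∀ {S U} → IsComplex (IndLink S U)
  IndLink-complex {S} = record
    { face-Unique = proj₁
    ; face-down = λ (_ , B⊆U , small) A! A⊆B → A! , ⊆-trans A⊆B B⊆U , SmallComponents-⊆ (++⁺ˡ S A⊆B) small }

  module _ {x : Vertex} {U S : List Vertex} (sep : Separated (x ∷ U) S) where

    x∉U : x ∉ U
    x∉U = Unique[x∷xs]⇒x∉xs (U-Unique sep)

    x∉face : ∀ {A} → A ⊆ U → x ∉ A
    x∉face A⊆U x∈A = x∉U (A⊆U x∈A)

    x∉face++S : ∀ {A} → A ⊆ U → x ∉ A ++ S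
    x∉face++S {A} A⊆U x∈ with ∈-++⁻ A x∈
    ... | inj₁ x∈A = x∉face A⊆U x∈A
    ... | inj₂ x∈S = disjoint sep (here refl) x∈S

    deletion⇒IndLink : ∀ {A} → deletion (IndLink S (x ∷ U)) x A → IndLink S U A
    deletion⇒IndLink ((A! , A⊆ , small) , x∉A) = A! , ⊆∷∧∉⇒⊆ A⊆ x∉A , small

    IndLink⇒deletion : ∀ {A} → IndLink S U A → deletion (IndLink S (x ∷ U)) x A
    IndLink⇒deletion (A! , A⊆U , small) = (A! , ⊆-trans A⊆U (xs⊆x∷xs U x) , small) , x∉face A⊆U

    link⇒IndLink : ∀ {A} → link (IndLink S (x ∷ U)) x A → IndLink (x ∷ S) U A
    link⇒IndLink {A} ((x∷A! , x∷A⊆ , small) , x∉A) =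
      tail x∷A! , ⊆∷∧∉⇒⊆ (⊆-trans (xs⊆x∷xs A x) x∷A⊆) x∉A ,
      SmallComponents-⊆ (⊆-reflexive-↭ (shift x A S)) small

    IndLink⇒link : ∀ {A} → IndLink (x ∷ S) U A → link (IndLink S (x ∷ U)) x A
    IndLink⇒link {A} (A! , A⊆U , small) =
      (Unique-∷ (x∉face A⊆U) A! , ∷⁺ʳ x A⊆U , SmallComponents-⊆ (⊆-reflexive-↭ (↭-sym (shift x A S))) small) ,
      x∉face A⊆U

    exchange⇒shedding : (∀ {A} → A ⊆ U → x ∉ A ++ S → SmallComponents (x ∷ A ++ S) →
                          ∃ λ y → y ∈ U × y ∉ A × SmallComponents (y ∷ A ++ S)) →
                        IsShedding (IndLink S (x ∷ U)) x
    exchange⇒shedding exchange {A} l@((_ , _ , small) , _) with link⇒IndLink l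
    ... | A! , A⊆U , _ with exchange A⊆U (x∉face++S A⊆U) small
    ...   | y , y∈U , y∉A , small' =
      y ∷ A , IndLink⇒deletion (Unique-∷ y∉A A! , ∈-∷⁺ʳ y∈U A⊆U , small') , xs⊆x∷xs A y ,
      λ y∷A⊆A → y∉A (y∷A⊆A (here refl))

    small-component⇒cone-point : length (component (x ∷ U ++ S) x) ≤ r → IsConePoint (IndLink S (x ∷ U)) x
    small-component⇒cone-point small-x {A} (A! , A⊆ , small) x∉A =
      Unique-∷ x∉A A! , ∈-∷⁺ʳ (here refl) A⊆ ,
      SmallComponents-∷ small (component Z x) small-x (λ p → ∈-component⁺ (reach-mono face⊆Z p))
      where
      Z = x ∷ U ++ S
      face⊆Z : x ∷ A ++ S ⊆ Z
      face⊆Z = ∈-∷⁺ʳ (here refl) (++⁺ˡ S A⊆)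

    IndLink-∷-shellable : ListShellable (IndLink S U) → ListShellable (IndLink (x ∷ S) U) →
                          IsShedding (IndLink S (x ∷ U)) x ⊎ IsConePoint (IndLink S (x ∷ U)) x →
                          ListShellable (IndLink S (x ∷ U))
    IndLink-∷-shellable (Fd , Fd-shelling) (Fl , Fl-shelling) (inj₁ shedding) =
      Fd ++ map (x ∷_) Fl ,
      vertex-decomposition IndLink-complex shedding
        (shelling-resp-⇔ IndLink⇒deletion deletion⇒IndLink Fd-shelling)
        (shelling-resp-⇔ IndLink⇒link link⇒IndLink Fl-shelling)
    IndLink-∷-shellable _ (Fl , Fl-shelling) (inj₂ cone) =
      map (x ∷_) Fl , cone-shelling IndLink-complex cone (shelling-resp-⇔ IndLink⇒link link⇒IndLink Fl-shelling)

  IndLink-[]-shellable : ∀ {S} → Unique S → ListShellable (IndLink S [])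
  IndLink-[]-shellable {S} S! with SmallComponents? S!
  ... | yes small = [] ∷ [] , point-shelling ([] , (λ ()) , small) (λ (_ , A⊆[] , _) → ⊆[]⇒≡[] A⊆[])
  ... | no ¬small = [] , empty-shelling λ {A} (_ , _ , small) → ¬small (SmallComponents-⊆ (xs⊆ys++xs S A) small)

  module WhiskerExchange {w : Whisker} {ws : List Whisker} {S : List Vertex}
                         (sep : Separated (inj₂ w ∷ map inj₂ ws) S)
                         {A : List Vertex} (A⊆U : A ⊆ map inj₂ ws) where

    Free : Vertex → Set
    Free z = z ∈ map inj₂ ws × z ∉ A

    free? : ∀ z → Dec (Free z)
    free? z = (z ∈? map inj₂ ws) ×-dec ¬? (z ∈? A)

    free-simplicial : ∀ {z} → Free z → Simplicial z
    free-simplicial (z∈ , _) with ∈-map⁻ inj₂ z∈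
    ... | w' , _ , refl = whisker-simplicial w'

    non-free-kept : ∀ {z} → z ∈ inj₂ w ∷ map inj₂ ws ++ S → ¬ Free z → z ∈ inj₂ w ∷ A ++ S
    non-free-kept (here z≡x) _ = here z≡x
    non-free-kept {z} (there z∈) ¬free with ∈-++⁻ (map inj₂ ws) z∈ | z ∈? A
    ... | inj₂ z∈S | _ = there (∈-++⁺ʳ A z∈S)
    ... | inj₁ _ | yes z∈A = there (∈-++⁺ˡ z∈A)
    ... | inj₁ z∈U | no z∉A = ⊥-elim (¬free (z∈U , z∉A))

    open Shortcut free? free-simplicial non-free-kept

    x-not-free : ¬ Free (inj₂ w)
    x-not-free (x∈U , _) = x∉U sep x∈U

    face-not-free : ∀ {z} → z ∈ A ++ S → ¬ Free z
    face-not-free z∈ (z∈U , z∉A) = [ z∉A , disjoint sep (there z∈U) ] (∈-++⁻ A z∈)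

    exchange : r < length (component (inj₂ w ∷ map inj₂ ws ++ S) (inj₂ w)) →
               inj₂ w ∉ A ++ S → SmallComponents (inj₂ w ∷ A ++ S) →
               ∃ λ y → y ∈ map inj₂ ws × y ∉ A × SmallComponents (y ∷ A ++ S)
    exchange large x∉ small with any? (λ y → ¬? (y ∈? A) ×-dec reach? (inj₂ w ∷ map inj₂ ws ++ S) (inj₂ w) y)
                                       (map inj₂ ws)
    ... | yes found with find found
    ...   | y , y∈U , y∉A , x→y = y , y∈U , y∉A , SmallComponents-exchange small x∉ y-edge
      where
      y-edge : ∀ {z} → z ∈ A ++ S → Edge y z → Reach Edge (inj₂ w ∷ A ++ S) (inj₂ w) z
      y-edge z∈ e =
        shortcut (reach-trans x→y (step (there (∈-++⁺ˡ y∈U)) e (here (there (++⁺ˡ S A⊆U z∈)))))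
          x-not-free (face-not-free z∈)
    exchange large x∉ small | no none = ⊥-elim $
      large-component small (here refl) _ (component-Unique (inj₂ w) (separated-Unique sep)) large
        λ z∈ → shortcut (∈-component⁻ z∈) x-not-free (λ (z∈U , z∉A) → none (lose z∈U (z∉A , ∈-component⁻ z∈)))

  whiskers-shellable : ∀ ws {S} → Separated (map inj₂ ws) S → ListShellable (IndLink S (map inj₂ ws))
  whiskers-shellable [] sep = IndLink-[]-shellable (S-Unique sep)
  whiskers-shellable (w ∷ ws) {S} sep =
    IndLink-∷-shellable sep (whiskers-shellable ws (separated-tail sep))
                            (whiskers-shellable ws (separated-move sep)) shedding-or-cone
    where
    shedding-or-cone : IsShedding (IndLink S (map inj₂ (w ∷ ws))) (inj₂ w) ⊎
                       IsConePoint (IndLink S (map inj₂ (w ∷ ws))) (inj₂ w)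
    shedding-or-cone with length (component (map inj₂ (w ∷ ws) ++ S) (inj₂ w)) ≤? r
    ... | yes small = inj₂ (small-component⇒cone-point sep small)
    ... | no large = inj₁ (exchange⇒shedding sep λ A⊆U → WhiskerExchange.exchange sep A⊆U (≰⇒> large))

  -- The only use of t_i ≥ r.
  whiskered-star : ∀ u {L} → (∀ a → inj₂ (part u , a) ∈ L) → ¬ SmallComponents (inj₁ u ∷ L)
  whiskered-star u {L} whiskers∈L small = small (inj₁ u) (here refl) star star-injective star-reach
    where
    i = part u
    star : Fin (suc r) → Vertex
    star zero = inj₁ u
    star (suc j) = inj₂ (i , inject≤ j (r≤t i))
    whisker-injective : ∀ {a b : Fin (t i)} → inj₂ {A = Fin n} (i , a) ≡ inj₂ (i , b) → a ≡ b
    whisker-injective refl = refl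
    star-injective : Injective _≡_ _≡_ star
    star-injective {zero} {zero} _ = refl
    star-injective {suc a} {suc b} eq = cong suc (inject≤-injective (r≤t i) (r≤t i) a b (whisker-injective eq))
    star-reach : ∀ j → Reach Edge (inj₁ u ∷ L) (inj₁ u) (star j)
    star-reach zero = here (here refl)
    star-reach (suc j) = step (here refl) refl (here (there (whiskers∈L _)))

  old-vertex-exchange : ∀ u {U S} → (∀ w → inj₂ w ∈ U) →
                        ∀ {A} → A ⊆ U → inj₁ u ∉ A ++ S → SmallComponents (inj₁ u ∷ A ++ S) →
                        ∃ λ y → y ∈ U × y ∉ A × SmallComponents (y ∷ A ++ S)
  old-vertex-exchange u {U} {S} whiskers∈U {A} _ u∉ small
    with any? (λ a → ¬? (inj₂ (part u , a) ∈? A)) (allFin (t (part u)))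
  ... | no none = ⊥-elim (whiskered-star u in-face small)
    where
    in-face : ∀ a → inj₂ (part u , a) ∈ A ++ S
    in-face a with inj₂ (part u , a) ∈? A
    ... | yes w∈A = ∈-++⁺ˡ w∈A
    ... | no w∉A = ⊥-elim (none (lose (∈-allFin a) w∉A))
  ... | yes found with find found
  ...   | a , _ , w∉A = inj₂ (part u , a) , whiskers∈U _ , w∉A , SmallComponents-exchange small u∉ w-edge
    where
    w-edge : ∀ {z} → z ∈ A ++ S → Edge (inj₂ (part u , a)) z → Reach Edge (inj₁ u ∷ A ++ S) (inj₁ u) z
    w-edge {z} z∈ e = step (here refl) (block-clique (sym (whisker-edge-block _ z e)) u≢z) (here (there z∈))
      where
      u≢z : inj₁ u ≢ z
      u≢z refl = u∉ z∈

  allWhiskers : List Whisker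
  allWhiskers = deduplicate _≟ʷ_ (concatMap (λ i → map (i ,_) (allFin (t i))) (allFin k))

  ∈-allWhiskers : ∀ w → w ∈ allWhiskers
  ∈-allWhiskers (i , a) =
    ∈-deduplicate⁺ _≟ʷ_
      (∈-concatMap⁺ (λ i → map (i ,_) (allFin (t i))) (lose (∈-allFin i) (∈-map⁺ (i ,_) (∈-allFin a))))

  old-vertices-shellable : ∀ us {S} → Separated (map inj₁ us ++ map inj₂ allWhiskers) S →
                           ListShellable (IndLink S (map inj₁ us ++ map inj₂ allWhiskers))
  old-vertices-shellable [] sep = whiskers-shellable allWhiskers sep
  old-vertices-shellable (u ∷ us) sep =
    IndLink-∷-shellable sep (old-vertices-shellable us (separated-tail sep))
                            (old-vertices-shellable us (separated-move sep))
      (inj₁ (exchange⇒shedding sep (old-vertex-exchange u whiskers∈U)))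
    where
    whiskers∈U : ∀ w → inj₂ w ∈ map inj₁ us ++ map inj₂ allWhiskers
    whiskers∈U w = ∈-++⁺ʳ (map inj₁ us) (∈-map⁺ inj₂ (∈-allWhiskers w))

  all-vertices : List Vertex
  all-vertices = map inj₁ (allFin n) ++ map inj₂ allWhiskers

  ∈-all-vertices : ∀ z → z ∈ all-vertices
  ∈-all-vertices (inj₁ u) = ∈-++⁺ˡ (∈-map⁺ inj₁ (∈-allFin u))
  ∈-all-vertices (inj₂ w) = ∈-++⁺ʳ (map inj₁ (allFin n)) (∈-map⁺ inj₂ (∈-allWhiskers w))

  all-vertices-separated : Separated all-vertices []
  all-vertices-separated = record
    { U-Unique = Unique-++⁺ (map⁺ inj₁-injective (allFin⁺ n)) (map⁺ inj₂-injective (deduplicate-! _≟ʷ_ _))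
                            old≢whisker
    ; S-Unique = []
    ; disjoint = λ _ () }
    where
    old≢whisker : ∀ {z} → ¬ (z ∈ map inj₁ (allFin n) × z ∈ map inj₂ allWhiskers)
    old≢whisker (z∈old , z∈whiskers) with ∈-map⁻ inj₁ z∈old | ∈-map⁻ inj₂ z∈whiskers
    ... | _ , _ , refl | _ , _ , ()

  shellable : Shellable (IsRIndependent Edge r)
  shellable with old-vertices-shellable (allFin n) all-vertices-separated
  ... | Fs , Fs-shelling = Fs , list-shelling⇒shelling (shelling-resp-⇔ to from Fs-shelling)
    where
    to : ∀ {A} → IndLink [] all-vertices A → IsRIndependent Edge r A
    to {A} (A! , _ , small) = A! , SmallComponents-⊆ (xs⊆xs++ys A []) small
    from : ∀ {A} → IsRIndependent Edge r A → IndLink [] all-vertices A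
    from {A} (A! , small) =
      A! , (λ {z} _ → ∈-all-vertices z) , SmallComponents-⊆ (⊆-reflexive (++-identityʳ A)) small

theorem5p4 : ∀ {n k : ℕ} (G : SimpleGraph n) (part : Fin n → Fin k) →
             IsCliquePartition G part →
             (r : ℕ) → 1 ≤ r →
             (t : Fin k → ℕ) → (∀ i → r ≤ t i) →
             Shellable (IsRIndependent (WAdj G part t) r)
theorem5p4 G part clique r _ t r≤t = Whiskering.shellable G part clique r t r≤t
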